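{- Let $\lambda=(h,1,1,\dots,1)$ be a hook partition. Then for every integer composition $\mathbf{w}$, every integral point of $\mathcal{P}_{\lambda,\mathbf{w}}$ is a vertex of $\mathcal{P}_{\lambda,\mathbf{w}}$.
   Context: $\mathcal{P}_{\lambda,\mathbf{w}}$ denotes $\mathcal{P}_{\lambda/\mu,\mathbf{w}}$ with $\mu$ the empty (zero) partition. An integer composition is a finite sequence of positive integers. For $\mathbf{w}=(w_1,\dots,w_{m-1})$, a Gelfand--Tsetlin (GT) pattern is a real array $(x^i_j)_{1\le i\le m,\,1\le j\le n}$ ($n$ at least the length of $\lambda$, partitions padded with zeros) with $x^{i+1}_j\ge x^i_j$ and $x^i_j\ge x^{i+1}_{j+1}$ whenever defined; $\mathcal{P}_{\lambda/\mu,\mathbf{w}}\subset\mathbb{R}^{mn}$ is the polytope of GT patterns with $\mathbf{x}^m=\lambda$, $\mathbf{x}^1=\mu$, and $\sum_jx^{i+1}_j-\sum_jx^i_j=w_i$ for $i=1,\dots,m-1$. An integral point is a pattern with all entries integers.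
   Formalization: The polytope $\mathcal{P}_{\lambda,\mathbf{w}}$ is taken in ℚ^(mn) instead of $\mathbb{R}^{mn}$, so the points and the coefficient of each convex combination in the vertex condition are rational. -}

module Defs where

open import Data.Nat as ℕ using (ℕ; zero; suc)
open import Data.Integer as ℤ using (ℤ)
open import Data.Rational as ℚ using (ℚ; 0ℚ; 1ℚ; _+_; _*_; _-_; _≤_; _<_)
open import Data.Fin as Fin using (Fin; toℕ; inject₁; fromℕ)
open import Data.Vec as Vec using (Vec; lookup)
open import Data.Product using (Σ; ∃; _×_)
open import Relation.Binary.PropositionalEquality using (_≡_)
open import Data.Bool using (if_then_else_)

ℕtoℚ : ℕ → ℚ
ℕtoℚ k = ℤ.+ k ℚ./ 1

sumFin : ∀ {n} → (Fin n → ℚ) → ℚ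
sumFin {zero} f = 0ℚ
sumFin {suc n} f = f Fin.zero + sumFin (λ j → f (Fin.suc j))

IsComposition : ∀ {r} → Vec ℕ r → Set
IsComposition {r} w = ∀ (i : Fin r) → 1 ℕ.≤ lookup w i

-- The hook partition (h,1,...,1) with k ones, padded with zeros to length n:
-- entry 0 is h, entries 1..k are 1, the rest 0.
hook : ∀ (h k n : ℕ) → Fin n → ℕ
hook h k n j with toℕ j
... | zero = h
... | suc t = if t ℕ.<ᵇ k then 1 else 0

-- A real (here: rational) array with m = r+1 rows (row index 0 is the
-- paper's row 1, row index r is the paper's row m) and n columns.
Array : ℕ → ℕ → Set
Array r n = Fin (suc r) → Fin n → ℚ

IsGT : ∀ {r n} → Array r n → Set
IsGT {r} {n} x =
  (∀ (i : Fin r) (j : Fin n) → x (inject₁ i) j ≤ x (Fin.suc i) j) ×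
  (∀ (i : Fin r) (j j' : Fin n) → toℕ j' ≡ suc (toℕ j) →
       x (Fin.suc i) j' ≤ x (inject₁ i) j)

-- Membership in P_{λ/μ,w} with μ = 0 (so P_{λ,w}), λ given as Fin n → ℕ.
InP : ∀ {r n} → (Fin n → ℕ) → Vec ℕ r → Array r n → Set
InP {r} {n} lam w x =
  IsGT x ×
  (∀ (j : Fin n) → x (fromℕ r) j ≡ ℕtoℚ (lam j)) ×
  (∀ (j : Fin n) → x Fin.zero j ≡ 0ℚ) ×
  (∀ (i : Fin r) → sumFin (x (Fin.suc i)) - sumFin (x (inject₁ i)) ≡ ℕtoℚ (lookup w i))

Integral : ∀ {r n} → Array r n → Set
Integral {r} {n} x = ∀ (i : Fin (suc r)) (j : Fin n) → ∃ λ (z : ℤ) → x i j ≡ z ℚ./ 1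

-- Vertex = extreme point: x is not a proper convex combination of two
-- distinct points of the polytope.
IsVertex : ∀ {r n} → (Array r n → Set) → Array r n → Set
IsVertex {r} {n} P x =
  P x ×
  (∀ (y z : Array r n) (t : ℚ) → P y → P z → 0ℚ < t → t < 1ℚ →
     (∀ i j → x i j ≡ t * y i j + (1ℚ - t) * z i j) →
     ∀ i j → y i j ≡ z i j)

{-# OPTIONS --safe #-}
-- Off the first column, the entries of a Gelfand–Tsetlin pattern of hook shape increase down
-- each column from 0 to λⱼ ∈ {0, 1}, so they lie in [0, 1]. An integral entry there is 0 or 1,
-- an extreme point of [0, 1]; hence if x = t y + (1 - t) z with y, z in the polytope and
-- 0 < t < 1, then y and z agree off the first column. The first column is then forced by the
-- row sums, which are the same for every point of the polytope.
module Submission where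

open import Defs
open import Data.Nat using (ℕ; zero; suc; _≤_; s≤s)
open import Data.Vec using (Vec)

open import Algebra.Properties.Group using (//-rightDividesˡ; ∙-cancelʳ; x∙y⁻¹≈ε⇒x≈y)
open import Data.Bool using (true; false)
open import Data.Fin using (Fin; inject₁; fromℕ; toℕ) renaming (zero to fzero; suc to fsuc)
open import Data.Fin.Induction using (<-weakInduction; >-weakInduction)
import Data.Nat as ℕ
open import Data.Integer as ℤ using (ℤ; -[1+_]; +≤+; 0ℤ; 1ℤ)
open import Data.Integer.GCD using (gcd; gcd-zeroʳ)
import Data.Integer.Properties as ℤ
open import Data.Product using (_×_; _,_; proj₁; proj₂)
open import Data.Rational
  using (ℚ; 0ℚ; 1ℚ; ↥_; ↧_; _/_; _+_; _*_; _-_; -_; _<_; positive; nonNegative)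
  renaming (_≤_ to _≤ℚ_)
open import Data.Rational.Properties
  using ( ≤-refl; ≤-trans; ≤-antisym; ≤-reflexive; <⇒≤; module ≤-Reasoning
        ; +-monoˡ-≤; +-monoʳ-≤; +-monoˡ-<; +-inverseʳ; +-identityʳ; +-comm; *-zeroʳ
        ; *-cancelˡ-≤-pos; *-monoˡ-≤-nonNeg; nonNegative⁻¹; drop-*≤*; ↥-/; ↧-/
        ; +-0-group)
open import Data.Rational.Solver using (module +-*-Solver)
open import Data.Sum as Sum using (_⊎_; inj₁; inj₂)
open import Relation.Binary.PropositionalEquality

open +-*-Solver

_∈[0,1] : ℚ → Set
p ∈[0,1] = 0ℚ ≤ℚ p × p ≤ℚ 1ℚ

p≤q⇒0≤q-p : ∀ {p q} → p ≤ℚ q → 0ℚ ≤ℚ q - p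
p≤q⇒0≤q-p {p} {q} p≤q = subst (_≤ℚ q - p) (+-inverseʳ p) (+-monoˡ-≤ (- p) p≤q)

p<q⇒0<q-p : ∀ {p q} → p < q → 0ℚ < q - p
p<q⇒0<q-p {p} {q} p<q = subst (_< q - p) (+-inverseʳ p) (+-monoˡ-< (- p) p<q)

0<p⇒0≤p*q : ∀ {p q} → 0ℚ < p → 0ℚ ≤ℚ q → 0ℚ ≤ℚ p * q
0<p⇒0≤p*q {p} 0<p 0≤q =
  subst (_≤ℚ p * _) (*-zeroʳ p) (*-monoˡ-≤-nonNeg p {{nonNegative (<⇒≤ 0<p)}} 0≤q)

0<p⇒p*q≡0⇒q≡0 : ∀ {p q} → 0ℚ < p → p * q ≡ 0ℚ → q ≡ 0ℚ
0<p⇒p*q≡0⇒q≡0 {p} 0<p pq≡0 = ≤-antisym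
  (*-cancelˡ-≤-pos p {{positive 0<p}} (≤-reflexive (trans pq≡0 (sym (*-zeroʳ p)))))
  (*-cancelˡ-≤-pos p {{positive 0<p}} (≤-reflexive (trans (*-zeroʳ p) (sym pq≡0))))

0≤p⇒0≤q⇒p+q≡0⇒p≡0 : ∀ {p q} → 0ℚ ≤ℚ p → 0ℚ ≤ℚ q → p + q ≡ 0ℚ → p ≡ 0ℚ
0≤p⇒0≤q⇒p+q≡0⇒p≡0 {p} {q} 0≤p 0≤q p+q≡0 = ≤-antisym p≤0 0≤p
  where
  open ≤-Reasoning
  p≤0 : p ≤ℚ 0ℚ
  p≤0 = begin
    p       ≡⟨ +-identityʳ p ⟨
    p + 0ℚ  ≤⟨ +-monoʳ-≤ p 0≤q ⟩
    p + q   ≡⟨ p+q≡0 ⟩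
    0ℚ      ∎

positive-combination≡0⇒≡0 : ∀ {t s a b} → 0ℚ < t → 0ℚ < s → 0ℚ ≤ℚ a → 0ℚ ≤ℚ b →
                            t * a + s * b ≡ 0ℚ → a ≡ 0ℚ
positive-combination≡0⇒≡0 0<t 0<s 0≤a 0≤b ta+sb≡0 =
  0<p⇒p*q≡0⇒q≡0 0<t (0≤p⇒0≤q⇒p+q≡0⇒p≡0 (0<p⇒0≤p*q 0<t 0≤a) (0<p⇒0≤p*q 0<s 0≤b) ta+sb≡0)

convex-combination≡0⇒≡0 : ∀ {t a b} → 0ℚ < t → t < 1ℚ → 0ℚ ≤ℚ a → 0ℚ ≤ℚ b →
                          t * a + (1ℚ - t) * b ≡ 0ℚ → a ≡ 0ℚ × b ≡ 0ℚ
convex-combination≡0⇒≡0 {t} {a} {b} 0<t t<1 0≤a 0≤b e =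
  positive-combination≡0⇒≡0 0<t (p<q⇒0<q-p t<1) 0≤a 0≤b e ,
  positive-combination≡0⇒≡0 (p<q⇒0<q-p t<1) 0<t 0≤b 0≤a (trans (+-comm _ (t * a)) e)

-- The case c = 1 reduces to c = 0 under the reflection p ↦ 1 - p of [0, 1].
0∨1-isExtreme : ∀ {t a b c} → 0ℚ < t → t < 1ℚ → a ∈[0,1] → b ∈[0,1] →
                c ≡ 0ℚ ⊎ c ≡ 1ℚ → c ≡ t * a + (1ℚ - t) * b → a ≡ b
0∨1-isExtreme 0<t t<1 (0≤a , _) (0≤b , _) (inj₁ refl) 0≡ta+sb
  with a≡0 , b≡0 ← convex-combination≡0⇒≡0 0<t t<1 0≤a 0≤b (sym 0≡ta+sb) = trans a≡0 (sym b≡0)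
0∨1-isExtreme {t} {a} {b} 0<t t<1 (_ , a≤1) (_ , b≤1) (inj₂ refl) 1≡ta+sb =
  trans (sym (x∙y⁻¹≈ε⇒x≈y +-0-group 1ℚ a (proj₁ 1-a≡0×1-b≡0)))
        (x∙y⁻¹≈ε⇒x≈y +-0-group 1ℚ b (proj₂ 1-a≡0×1-b≡0))
  where
  reflection : ∀ t a b → t * (1ℚ - a) + (1ℚ - t) * (1ℚ - b) ≡ 1ℚ - (t * a + (1ℚ - t) * b)
  reflection = solve 3 (λ t a b →
    t :* (con 1ℚ :- a) :+ (con 1ℚ :- t) :* (con 1ℚ :- b) := con 1ℚ :- (t :* a :+ (con 1ℚ :- t) :* b)) refl
  reflected : t * (1ℚ - a) + (1ℚ - t) * (1ℚ - b) ≡ 0ℚ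
  reflected = trans (reflection t a b) (trans (cong (λ p → 1ℚ - p) (sym 1≡ta+sb)) (+-inverseʳ 1ℚ))
  1-a≡0×1-b≡0 : 1ℚ - a ≡ 0ℚ × 1ℚ - b ≡ 0ℚ
  1-a≡0×1-b≡0 = convex-combination≡0⇒≡0 0<t t<1 (p≤q⇒0≤q-p a≤1) (p≤q⇒0≤q-p b≤1) reflected

↥[i/1]≡i : ∀ i → ↥ (i / 1) ≡ i
↥[i/1]≡i i = begin
  ↥ (i / 1)                  ≡⟨ ℤ.*-identityʳ _ ⟨
  ↥ (i / 1) ℤ.* 1ℤ           ≡⟨ cong (↥ (i / 1) ℤ.*_) (gcd-zeroʳ i) ⟨
  ↥ (i / 1) ℤ.* gcd i 1ℤ     ≡⟨ ↥-/ i 1 ⟩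
  i                          ∎
  where open ≡-Reasoning

↧[i/1]≡1 : ∀ i → ↧ (i / 1) ≡ 1ℤ
↧[i/1]≡1 i = begin
  ↧ (i / 1)                  ≡⟨ ℤ.*-identityʳ _ ⟨
  ↧ (i / 1) ℤ.* 1ℤ           ≡⟨ cong (↧ (i / 1) ℤ.*_) (gcd-zeroʳ i) ⟨
  ↧ (i / 1) ℤ.* gcd i 1ℤ     ≡⟨ ↧-/ i 1 ⟩
  1ℤ                         ∎
  where open ≡-Reasoning

/1-cancel-≤ : ∀ {i j} → i / 1 ≤ℚ j / 1 → i ℤ.≤ j
/1-cancel-≤ {i} {j} i≤j = subst₂ ℤ._≤_ (numerator i j) (numerator j i) (drop-*≤* i≤j)
  where
  numerator : ∀ i j → ↥ (i / 1) ℤ.* ↧ (j / 1) ≡ i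
  numerator i j = trans (cong₂ ℤ._*_ (↥[i/1]≡i i) (↧[i/1]≡1 j)) (ℤ.*-identityʳ i)

0≤i≤1⇒i≡0∨i≡1 : ∀ {i} → 0ℤ ℤ.≤ i → i ℤ.≤ 1ℤ → i ≡ 0ℤ ⊎ i ≡ 1ℤ
0≤i≤1⇒i≡0∨i≡1 {ℤ.+ 0}           _ _               = inj₁ refl
0≤i≤1⇒i≡0∨i≡1 {ℤ.+ 1}           _ _               = inj₂ refl
0≤i≤1⇒i≡0∨i≡1 {ℤ.+ suc (suc _)} _ (+≤+ (s≤s ()))
0≤i≤1⇒i≡0∨i≡1 { -[1+ _ ]}       () _

integral∈[0,1]⇒0∨1 : ∀ {p} (i : ℤ) → p ≡ i / 1 → p ∈[0,1] → p ≡ 0ℚ ⊎ p ≡ 1ℚ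
integral∈[0,1]⇒0∨1 i refl (0≤p , p≤1) = Sum.map (cong (_/ 1)) (cong (_/ 1))
  (0≤i≤1⇒i≡0∨i≡1 (/1-cancel-≤ {0ℤ} {i} 0≤p) (/1-cancel-≤ {i} {1ℤ} p≤1))

sumFin-cong : ∀ {n} {f g : Fin n → ℚ} → (∀ j → f j ≡ g j) → sumFin f ≡ sumFin g
sumFin-cong {zero}  f≗g = refl
sumFin-cong {suc n}  f≗g = cong₂ _+_ (f≗g fzero) (sumFin-cong (λ j → f≗g (fsuc j)))

module _ {r n} (lam : Fin n → ℕ) (w : Vec ℕ r) where

  InP-bounds : ∀ x → InP lam w x → ∀ i j → 0ℚ ≤ℚ x i j × x i j ≤ℚ ℕtoℚ (lam j)
  InP-bounds x ((down , _) , top , bottom , _) i j =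
    subst (_≤ℚ x i j) (bottom j)
      (<-weakInduction (λ i → x fzero j ≤ℚ x i j) ≤-refl (λ i p → ≤-trans p (down i j)) i) ,
    subst (x i j ≤ℚ_) (top j)
      (>-weakInduction (λ i → x i j ≤ℚ x (fromℕ r) j) ≤-refl (λ i p → ≤-trans (down i j) p) i)

  InP-rowSums-agree : ∀ y z → InP lam w y → InP lam w z → ∀ i → sumFin (y i) ≡ sumFin (z i)
  InP-rowSums-agree y z (_ , _ , y-bottom , y-steps) (_ , _ , z-bottom , z-steps) =
    <-weakInduction (λ i → sumFin (y i) ≡ sumFin (z i))
      (sumFin-cong (λ j → trans (y-bottom j) (sym (z-bottom j)))) step
    where
    open ≡-Reasoning
    step : ∀ i → sumFin (y (inject₁ i)) ≡ sumFin (z (inject₁ i)) →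
           sumFin (y (fsuc i)) ≡ sumFin (z (fsuc i))
    step i ih = begin
      sumFin (y (fsuc i))
        ≡⟨ //-rightDividesˡ +-0-group _ _ ⟨
      (sumFin (y (fsuc i)) - sumFin (y (inject₁ i))) + sumFin (y (inject₁ i))
        ≡⟨ cong₂ _+_ (trans (y-steps i) (sym (z-steps i))) ih ⟩
      (sumFin (z (fsuc i)) - sumFin (z (inject₁ i))) + sumFin (z (inject₁ i))
        ≡⟨ //-rightDividesˡ +-0-group _ _ ⟩
      sumFin (z (fsuc i)) ∎

InP-≡-from-tail : ∀ {r n} (lam : Fin (suc n) → ℕ) (w : Vec ℕ r) y z → InP lam w y → InP lam w z →
                  (∀ i j → y i (fsuc j) ≡ z i (fsuc j)) → ∀ i j → y i j ≡ z i j
InP-≡-from-tail lam w y z y∈P z∈P tails-agree i (fsuc j) = tails-agree i j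
InP-≡-from-tail lam w y z y∈P z∈P tails-agree i fzero =
  ∙-cancelʳ +-0-group (sumFin (λ j → y i (fsuc j))) (y i fzero) (z i fzero) (begin
    y i fzero + sumFin (λ j → y i (fsuc j))  ≡⟨ InP-rowSums-agree lam w y z y∈P z∈P i ⟩
    z i fzero + sumFin (λ j → z i (fsuc j))  ≡⟨ cong (z i fzero +_) (sumFin-cong (tails-agree i)) ⟨
    z i fzero + sumFin (λ j → y i (fsuc j))  ∎)
  where open ≡-Reasoning

hook-tail≤1 : ∀ h k n (j : Fin n) → ℕtoℚ (hook h k (suc n) (fsuc j)) ≤ℚ 1ℚ
hook-tail≤1 h k n j with toℕ j ℕ.<ᵇ k
... | true  = ≤-refl
... | false = nonNegative⁻¹ 1ℚ

mainTheorem8 : (h k n r : ℕ) → 1 ≤ h → suc k ≤ n →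
    (w : Vec ℕ r) → IsComposition w →
    (x : Array r n) → InP (hook h k n) w x → Integral x →
    IsVertex (InP (hook h k n) w) x
mainTheorem8 h k zero    r _ () _ _ _ _ _
mainTheorem8 h k (suc n) r _ _ w _ x x∈P x-integral = x∈P , decomposition-trivial
  where
  tail∈[0,1] : ∀ u → InP (hook h k (suc n)) w u → ∀ i j → u i (fsuc j) ∈[0,1]
  tail∈[0,1] u u∈P i j with 0≤u , u≤λ ← InP-bounds (hook h k (suc n)) w u u∈P i (fsuc j) =
    0≤u , ≤-trans u≤λ (hook-tail≤1 h k n j)

  decomposition-trivial : ∀ y z t → InP (hook h k (suc n)) w y → InP (hook h k (suc n)) w z →
    0ℚ < t → t < 1ℚ → (∀ i j → x i j ≡ t * y i j + (1ℚ - t) * z i j) → ∀ i j → y i j ≡ z i j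
  decomposition-trivial y z t y∈P z∈P 0<t t<1 x≡ty+sz =
    InP-≡-from-tail (hook h k (suc n)) w y z y∈P z∈P tails-agree
    where
    tails-agree : ∀ i j → y i (fsuc j) ≡ z i (fsuc j)
    tails-agree i j with c , x≡c ← x-integral i (fsuc j) =
      0∨1-isExtreme 0<t t<1 (tail∈[0,1] y y∈P i j) (tail∈[0,1] z z∈P i j)
        (integral∈[0,1]⇒0∨1 c x≡c (tail∈[0,1] x x∈P i j)) (x≡ty+sz i (fsuc j))
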